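{- Let $n\ge 2$ be an integer and let $f:\mathbb{Z}/n\mathbb{Z}\to\mathbb{Z}/n\mathbb{Z}$. The following conditions are equivalent: (1) $f$ is congruence preserving, i.e. for all $x,y\in\mathbb{Z}/n\mathbb{Z}$ there exists $d\in\mathbb{Z}/n\mathbb{Z}$ with $f(x)-f(y)=d(x-y)$; (2) there exists a function $F:\mathbb{N}\to\mathbb{N}$ which is congruence preserving (i.e. for all $a,b\in\mathbb{N}$, $a-b$ divides $F(a)-F(b)$ in $\mathbb{Z}$) and which satisfies $\pi_n\circ F=f\circ\pi_n$ on $\mathbb{N}$.
   Context: For an integer $k\ge1$, $\pi_k:\mathbb{Z}\to\mathbb{Z}/k\mathbb{Z}$ denotes the canonical surjective ring homomorphism (here applied to elements of $\mathbb{N}\subseteq\mathbb{Z}$). -}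

module Defs where

open import Data.Nat using (ℕ; suc; _+_; _*_; _∸_; NonZero)
open import Data.Nat.DivMod using (_mod_)
open import Data.Fin using (Fin; toℕ)
open import Data.Integer using (ℤ; +_; _-_)
open import Data.Integer.Divisibility using (_∣_)
open import Data.Product using (∃)
open import Relation.Binary.PropositionalEquality using (_≡_)

-- ℤ/nℤ is represented by Fin n (canonical residues 0,…,n-1),
-- with ring operations computed modulo n.


subₙ : (n : ℕ) .{{_ : NonZero n}} → Fin n → Fin n → Fin n
subₙ n x y = (toℕ x + (n ∸ toℕ y)) mod n

mulₙ : (n : ℕ) .{{_ : NonZero n}} → Fin n → Fin n → Fin n
mulₙ n x y = (toℕ x * toℕ y) mod n

π : (n : ℕ) .{{_ : NonZero n}} → ℕ → Fin n
π n a = a mod n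

CongPresₙ : (n : ℕ) .{{_ : NonZero n}} → (Fin n → Fin n) → Set
CongPresₙ n f = ∀ (x y : Fin n) → ∃ λ (d : Fin n) →
  subₙ n (f x) (f y) ≡ mulₙ n d (subₙ n x y)

CongPresℕ : (ℕ → ℕ) → Set
CongPresℕ F = ∀ (a b : ℕ) → (+ a - + b) ∣ (+ F a - + F b)

module Submission where

-- (2) ⇒ (1) is a calculation: for residues x, y the integer q with
-- F x - F y = q (x - y), reduced mod n, is the required factor d.
-- (1) ⇒ (2) builds F one value at a time.  Let g a be the representative of
-- f (a mod n).  The value F m must satisfy F m ≡ g m (mod n) and F m ≡ F b
-- (mod m - b) for every b < m.  These congruences are pairwise compatible
-- (r - s ∈ aℤ + bℤ): against g m because f is congruence preserving, among
-- themselves because F already is so on [0, m).  A Chinese remainder theorem for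
-- non-coprime moduli therefore provides F m.

open import Defs
open import Data.Nat as ℕ using (ℕ; zero; suc; NonZero; _<_; _≤_; _∸_; _%_; _<?_)
open import Relation.Nullary using (yes; no; contradiction)
import Data.Nat.Properties as ℕP
open import Data.Integer as ℤ using (ℤ; +_; _+_; _*_; _-_; -_; 0ℤ; _%ℕ_; _/ℕ_)
import Data.Integer.Properties as ℤP
open import Data.Integer.DivMod using (a≡a%ℕn+[a/ℕn]*n)
open import Data.Integer.Divisibility.Signed using (_∣_; divides; ∣-trans; ∣⇒∣ᵤ; ∣ᵤ⇒∣)
open import Data.Integer.Tactic.RingSolver using (solve-∀)
open import Data.Sum using (inj₁; inj₂)
open import Data.Fin using (Fin; toℕ)
open import Data.Fin.Properties using (toℕ-fromℕ<; toℕ-injective; toℕ<n; toℕ≤n)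
open import Data.Nat.DivMod using (m<n⇒m%n≡m; [m+kn]%n≡m%n)
import Data.Nat.Divisibility as ℕ
open import Data.Nat.GCD using (module Bézout; module GCD)
open import Data.List using (List; []; _∷_; applyUpTo)
open import Data.List.Relation.Unary.All as All using (All; []; _∷_; zipWith)
open import Data.List.Relation.Unary.AllPairs using (AllPairs; []; _∷_)
import Data.List.Relation.Unary.AllPairs.Properties as AllPairs
import Data.List.Relation.Unary.All.Properties as All
open import Data.Product using (∃; _×_; _,_; proj₁; proj₂)
open import Level using (0ℓ)
open import Function.Bundles using (_⇔_; mk⇔)
open import Relation.Binary.Definitions using (tri<; tri≈; tri>)
open import Relation.Binary.Bundles using (Setoid)
import Relation.Binary.Reasoning.Setoid as SetoidReasoning
open import Relation.Binary.PropositionalEquality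

infix 4 _≡_[mod_] _∈⟨_,_⟩

-- x ≡ y (mod m) for integers x, y and a natural modulus m; a record (rather
-- than a synonym for divisibility) so that x, y and m can be inferred
record _≡_[mod_] (x y : ℤ) (m : ℕ) : Set where
  constructor mod∣
  field modulus∣difference : + m ∣ x - y

infix 5 _·mod_
pattern _·mod_ q e = mod∣ (divides q e)

module _ {m : ℕ} where

  ≡-refl : ∀ {x} → x ≡ x [mod m ]
  ≡-refl {x} = 0ℤ ·mod ℤP.+-inverseʳ x

  ≡-reflexive : ∀ {x y} → x ≡ y → x ≡ y [mod m ]
  ≡-reflexive refl = ≡-refl

  ≡-sym : ∀ {x y} → x ≡ y [mod m ] → y ≡ x [mod m ]
  ≡-sym {x} {y} (q ·mod e) = - q ·mod (begin
    y - x        ≡⟨ flip x y ⟩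
    - (x - y)    ≡⟨ cong -_ e ⟩
    - (q * + m)  ≡⟨ ℤP.neg-distribˡ-* q (+ m) ⟩
    - q * + m    ∎)
    where open ≡-Reasoning
          flip : ∀ x y → y - x ≡ - (x - y)
          flip = solve-∀

  ≡-trans : ∀ {x y z} → x ≡ y [mod m ] → y ≡ z [mod m ] → x ≡ z [mod m ]
  ≡-trans {x} {y} {z} (p ·mod e) (q ·mod e′) = p + q ·mod (begin
    x - z                ≡⟨ split x y z ⟩
    (x - y) + (y - z)    ≡⟨ cong₂ _+_ e e′ ⟩
    p * + m + q * + m    ≡⟨ ℤP.*-distribʳ-+ (+ m) p q ⟨
    (p + q) * + m        ∎)
    where open ≡-Reasoning
          split : ∀ x y z → x - z ≡ (x - y) + (y - z)
          split = solve-∀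

  ≡-- : ∀ {a b c d} → a ≡ b [mod m ] → c ≡ d [mod m ] → a - c ≡ b - d [mod m ]
  ≡-- {a} {b} {c} {d} (p ·mod e) (q ·mod e′) = p - q ·mod (begin
    (a - c) - (b - d)    ≡⟨ split a b c d ⟩
    (a - b) - (c - d)    ≡⟨ cong₂ _-_ e e′ ⟩
    p * + m - q * + m    ≡⟨ regroup p q (+ m) ⟩
    (p - q) * + m        ∎)
    where open ≡-Reasoning
          split : ∀ a b c d → (a - c) - (b - d) ≡ (a - b) - (c - d)
          split = solve-∀
          regroup : ∀ p q m → p * m - q * m ≡ (p - q) * m
          regroup = solve-∀

  ≡-* : ∀ {a b c d} → a ≡ b [mod m ] → c ≡ d [mod m ] → a * c ≡ b * d [mod m ]
  ≡-* {a} {b} {c} {d} (p ·mod e) (q ·mod e′) = a * q + p * d ·mod (begin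
    a * c - b * d                ≡⟨ split a b c d ⟩
    a * (c - d) + (a - b) * d    ≡⟨ cong₂ (λ u v → a * u + v * d) e′ e ⟩
    a * (q * + m) + p * + m * d  ≡⟨ regroup a q p d (+ m) ⟩
    (a * q + p * d) * + m        ∎)
    where open ≡-Reasoning
          split : ∀ a b c d → a * c - b * d ≡ a * (c - d) + (a - b) * d
          split = solve-∀
          regroup : ∀ a q p d m → a * (q * m) + p * m * d ≡ (a * q + p * d) * m
          regroup = solve-∀

  ≡-*ˡ : ∀ c {a b} → a ≡ b [mod m ] → c * a ≡ c * b [mod m ]
  ≡-*ˡ c = ≡-* (≡-refl {x = c})

≡-setoid : ℕ → Setoid 0ℓ 0ℓ
≡-setoid m = record
  { Carrier       = ℤ
  ; _≈_           = _≡_[mod m ]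
  ; isEquivalence = record { refl = ≡-refl ; sym = ≡-sym ; trans = ≡-trans } }

module ≡-mod-Reasoning (m : ℕ) = SetoidReasoning (≡-setoid m)

≡-weaken : ∀ {k l x y} → + k ∣ + l → x ≡ y [mod l ] → x ≡ y [mod k ]
≡-weaken k∣l (mod∣ l∣x-y) = mod∣ (∣-trans k∣l l∣x-y)

%ℕ-≡ : ∀ x m .{{_ : NonZero m}} → + (x %ℕ m) ≡ x [mod m ]
%ℕ-≡ x m = - (x /ℕ m) ·mod (begin
  + (x %ℕ m) - x                            ≡⟨ cong (λ t → + (x %ℕ m) - t) (a≡a%ℕn+[a/ℕn]*n x m) ⟩
  + (x %ℕ m) - (+ (x %ℕ m) + x /ℕ m * + m)  ≡⟨ cancel (+ (x %ℕ m)) (x /ℕ m) (+ m) ⟩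
  - (x /ℕ m) * + m                          ∎)
  where open ≡-Reasoning
        cancel : ∀ r q m → r - (r + q * m) ≡ - q * m
        cancel = solve-∀

+-∸ : ∀ {a b} → b ≤ a → + (a ∸ b) ≡ + a - + b
+-∸ {a} {b} b≤a = trans (sym (ℤP.⊖-≥ b≤a)) (sym (ℤP.m-n≡m⊖n a b))

module Residues (n : ℕ) .{{_ : NonZero n}} where

  rep : Fin n → ℤ
  rep x = + toℕ x

  rep-π : ∀ a → rep (π n a) ≡ + a [mod n ]
  rep-π a = subst (λ r → + r ≡ + a [mod n ]) (sym (toℕ-fromℕ< _)) (%ℕ-≡ (+ a) n)

  residue-unique-≤ : ∀ {a b} → a ≤ b → a < n → b < n → + b ≡ + a [mod n ] → a ≡ b
  residue-unique-≤ {a} {b} a≤b a<n b<n (mod∣ n∣b-a) with ∣⇒∣ᵤ n∣b-a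
  ... | ℕ.divides k b-a≡kn = begin
    a                    ≡⟨ m<n⇒m%n≡m a<n ⟨
    a % n                ≡⟨ [m+kn]%n≡m%n a k n ⟨
    (a ℕ.+ k ℕ.* n) % n  ≡⟨ cong (λ t → (a ℕ.+ t) % n) kn≡b-a ⟩
    (a ℕ.+ (b ∸ a)) % n  ≡⟨ cong (_% n) (ℕP.m+[n∸m]≡n a≤b) ⟩
    b % n                ≡⟨ m<n⇒m%n≡m b<n ⟩
    b                    ∎
    where open ≡-Reasoning
          kn≡b-a : k ℕ.* n ≡ b ∸ a
          kn≡b-a = sym (trans (cong ℤ.∣_∣ (+-∸ a≤b)) b-a≡kn)

  residue-unique : ∀ {a b} → a < n → b < n → + a ≡ + b [mod n ] → a ≡ b
  residue-unique {a} {b} a<n b<n a≡b with ℕP.≤-total a b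
  ... | inj₁ a≤b = residue-unique-≤ a≤b a<n b<n (≡-sym a≡b)
  ... | inj₂ b≤a = sym (residue-unique-≤ b≤a b<n a<n a≡b)

  rep-injective : ∀ {x y} → rep x ≡ rep y [mod n ] → x ≡ y
  rep-injective {x} {y} x≡y = toℕ-injective (residue-unique (toℕ<n x) (toℕ<n y) x≡y)

  rep-sub : ∀ x y → rep (subₙ n x y) ≡ rep x - rep y [mod n ]
  rep-sub x y = ≡-trans (rep-π (toℕ x ℕ.+ (n ∸ toℕ y))) (+ 1 ·mod (begin
    + (toℕ x ℕ.+ (n ∸ toℕ y)) - (rep x - rep y)    ≡⟨ cong (_- (rep x - rep y)) (ℤP.pos-+ (toℕ x) _) ⟩
    (rep x + + (n ∸ toℕ y)) - (rep x - rep y)      ≡⟨ cong (λ t → (rep x + t) - (rep x - rep y)) (+-∸ (toℕ≤n y)) ⟩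
    (rep x + (+ n - rep y)) - (rep x - rep y)      ≡⟨ cancel (rep x) (rep y) (+ n) ⟩
    + 1 * + n                                      ∎))
    where open ≡-Reasoning
          cancel : ∀ x y n → (x + (n - y)) - (x - y) ≡ + 1 * n
          cancel = solve-∀

  rep-mul : ∀ x y → rep (mulₙ n x y) ≡ rep x * rep y [mod n ]
  rep-mul x y = subst (λ t → rep (mulₙ n x y) ≡ t [mod n ]) (ℤP.pos-* (toℕ x) (toℕ y))
                      (rep-π (toℕ x ℕ.* toℕ y))

-- Ideals aℤ + bℤ and the generalised Chinese remainder theorem

record _∈⟨_,_⟩ (D a b : ℤ) : Set where
  constructor combination
  field
    u v : ℤ
    equation : D ≡ u * a + v * b

∈-resp-≡ : ∀ {a k D D′} → D ∈⟨ a , + k ⟩ → D ≡ D′ [mod k ] → D′ ∈⟨ a , + k ⟩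
∈-resp-≡ {a} {k} {D} {D′} (combination u v e) (q ·mod e′) = combination u (v - q) (begin
  D′                        ≡⟨ shift D D′ ⟩
  D - (D - D′)              ≡⟨ cong₂ _-_ e e′ ⟩
  u * a + v * + k - q * + k ≡⟨ regroup u v q a (+ k) ⟩
  u * a + (v - q) * + k     ∎)
  where open ≡-Reasoning
        shift : ∀ D D′ → D′ ≡ D - (D - D′)
        shift = solve-∀
        regroup : ∀ u v q a k → u * a + v * k - q * k ≡ u * a + (v - q) * k
        regroup = solve-∀

∈-from-≡ : ∀ {x n} d k → x ≡ d * k [mod n ] → x ∈⟨ + n , k ⟩
∈-from-≡ {x} {n} d k (q ·mod e) = combination q d (begin
  x                    ≡⟨ split x (d * k) ⟩
  (x - d * k) + d * k  ≡⟨ cong (_+ d * k) e ⟩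
  q * + n + d * k      ∎)
  where open ≡-Reasoning
        split : ∀ x y → x ≡ (x - y) + y
        split = solve-∀

∈-from-difference : ∀ {x y k A B} → y ≡ x [mod k ] → + k ≡ A - B → x - y ∈⟨ A , B ⟩
∈-from-difference {x} {y} {k} {A} {B} (q ·mod e) k≡A-B = combination (- q) q (begin
  x - y              ≡⟨ flip x y ⟩
  - (y - x)          ≡⟨ cong -_ e ⟩
  - (q * + k)        ≡⟨ cong (λ t → - (q * t)) k≡A-B ⟩
  - (q * (A - B))    ≡⟨ expand q A B ⟩
  - q * A + q * B    ∎)
  where open ≡-Reasoning
        flip : ∀ x y → x - y ≡ - (y - x)
        flip = solve-∀
        expand : ∀ q A B → - (q * (A - B)) ≡ - q * A + q * B
        expand = solve-∀

+-cast : ∀ d y c x b → d ℕ.+ y ℕ.* c ≡ x ℕ.* b → + d + + y * + c ≡ + x * + b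
+-cast d y c x b eq = begin
  + d + + y * + c    ≡⟨ cong (λ t → + d + t) (ℤP.pos-* y c) ⟨
  + d + + (y ℕ.* c)  ≡⟨ ℤP.pos-+ d (y ℕ.* c) ⟨
  + (d ℕ.+ y ℕ.* c)  ≡⟨ cong +_ eq ⟩
  + (x ℕ.* b)        ≡⟨ ℤP.pos-* x b ⟩
  + x * + b          ∎
  where open ≡-Reasoning

-- Bézout's identity of the standard library (stated in ℕ with two sign
-- patterns) as membership in an ideal of ℤ
bézout : ∀ {d b c} → Bézout.Identity d b c → + d ∈⟨ + b , + c ⟩
bézout {d} {b} {c} (Bézout.+- x y eq) =
  combination (+ x) (- + y) (isolate (+ d) (+ y) (+ c) (+ x * + b) (+-cast d y c x b eq))
  where isolate : ∀ d y c t → d + y * c ≡ t → d ≡ t + - y * c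
        isolate d y c t eq = trans (expand d y c) (cong (_+ - y * c) eq)
          where expand : ∀ d y c → d ≡ d + y * c + - y * c
                expand = solve-∀
bézout {d} {b} {c} (Bézout.-+ x y eq) =
  combination (- + x) (+ y) (isolate (+ d) (+ x) (+ b) (+ y * + c) (+-cast d x b y c eq))
  where isolate : ∀ d x b t → d + x * b ≡ t → d ≡ - x * b + t
        isolate d x b t eq = trans (expand d x b) (cong (λ t → - x * b + t) eq)
          where expand : ∀ d x b → d ≡ - x * b + (d + x * b)
                expand = solve-∀

-- If α·b′ + β·c′ = 1 then (aℤ + b′dℤ) ∩ (aℤ + c′dℤ) ⊆ aℤ + b′c′dℤ:
-- the ideal-theoretic content of lcm(b′d, c′d) = b′c′d for coprime b′, c′
∈-meet : ∀ {α β b′ c′ d a D} → α * b′ + β * c′ ≡ + 1 →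
         D ∈⟨ a , b′ * d ⟩ → D ∈⟨ a , c′ * d ⟩ → D ∈⟨ a , b′ * (c′ * d) ⟩
∈-meet {α} {β} {b′} {c′} {d} {a} {D} unit (combination u₁ v₁ e₁) (combination u₂ v₂ e₂) =
  combination (α * b′ * u₂ + β * c′ * u₁) (α * v₂ + β * v₁) (begin
  D                                 ≡⟨ ℤP.*-identityˡ D ⟨
  + 1 * D                           ≡⟨ cong (_* D) unit ⟨
  (α * b′ + β * c′) * D             ≡⟨ ℤP.*-distribʳ-+ D (α * b′) (β * c′) ⟩
  α * b′ * D + β * c′ * D           ≡⟨ cong₂ (λ s t → α * b′ * s + β * c′ * t) e₂ e₁ ⟩
  α * b′ * (u₂ * a + v₂ * (c′ * d)) + β * c′ * (u₁ * a + v₁ * (b′ * d))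
                                    ≡⟨ regroup α β b′ c′ d a u₁ v₁ u₂ v₂ ⟩
  (α * b′ * u₂ + β * c′ * u₁) * a + (α * v₂ + β * v₁) * (b′ * (c′ * d)) ∎)
  where open ≡-Reasoning
        regroup : ∀ α β b′ c′ d a u₁ v₁ u₂ v₂ →
          α * b′ * (u₂ * a + v₂ * (c′ * d)) + β * c′ * (u₁ * a + v₁ * (b′ * d))
            ≡ (α * b′ * u₂ + β * c′ * u₁) * a + (α * v₂ + β * v₁) * (b′ * (c′ * d))
        regroup = solve-∀

-- A least common multiple of b and c, characterised by the property the
-- Chinese remainder theorem needs: (aℤ + bℤ) ∩ (aℤ + cℤ) ⊆ aℤ + lℤ
record CommonMultiple (b c : ℕ) : Set where
  field
    l       : ℕ
    nonZero : NonZero l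
    b∣l     : + b ∣ + l
    c∣l     : + c ∣ + l
    meet    : ∀ {a D} → D ∈⟨ a , + b ⟩ → D ∈⟨ a , + c ⟩ → D ∈⟨ a , + l ⟩

lcm-from-gcd : ∀ b′ c′ d .{{_ : NonZero b′}} .{{_ : NonZero c′}} .{{_ : NonZero d}} →
  + d ∈⟨ + (b′ ℕ.* d) , + (c′ ℕ.* d) ⟩ → CommonMultiple (b′ ℕ.* d) (c′ ℕ.* d)
lcm-from-gcd b′ c′ d (combination α β d≡αb+βc) = record
  { l       = b′ ℕ.* (c′ ℕ.* d)
  ; nonZero = ℕP.m*n≢0 b′ (c′ ℕ.* d)
  ; b∣l     = ∣ᵤ⇒∣ (ℕ.*-monoʳ-∣ b′ (ℕ.n∣m*n c′))
  ; c∣l     = ∣ᵤ⇒∣ (ℕ.n∣m*n b′)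
  ; meet    = λ {a} {D} D∈b D∈c →
      subst (λ t → D ∈⟨ a , t ⟩) (sym +b′c′d)
        (∈-meet {α} {β} {+ b′} {+ c′} {+ d} unit (subst (λ t → D ∈⟨ a , t ⟩) (ℤP.pos-* b′ d) D∈b)
                     (subst (λ t → D ∈⟨ a , t ⟩) (ℤP.pos-* c′ d) D∈c))
  }
  where
  open ≡-Reasoning
  instance _ = ℕP.m*n≢0 c′ d
  +b′c′d : + (b′ ℕ.* (c′ ℕ.* d)) ≡ + b′ * (+ c′ * + d)
  +b′c′d = trans (ℤP.pos-* b′ (c′ ℕ.* d)) (cong (+ b′ *_) (ℤP.pos-* c′ d))
  -- dividing d = α·b′d + β·c′d by d
  unit : α * + b′ + β * + c′ ≡ + 1
  unit = ℤP.*-cancelˡ-≡ (+ d) _ _ (begin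
    + d * (α * + b′ + β * + c′)          ≡⟨ distribute (+ d) α β (+ b′) (+ c′) ⟩
    α * (+ b′ * + d) + β * (+ c′ * + d)  ≡⟨ cong₂ (λ s t → α * s + β * t) (ℤP.pos-* b′ d) (ℤP.pos-* c′ d) ⟨
    α * + (b′ ℕ.* d) + β * + (c′ ℕ.* d)  ≡⟨ d≡αb+βc ⟨
    + d                                  ≡⟨ ℤP.*-identityʳ (+ d) ⟨
    + d * + 1                            ∎)
    where distribute : ∀ d α β b′ c′ → d * (α * b′ + β * c′) ≡ α * (b′ * d) + β * (c′ * d)
          distribute = solve-∀

-- b = b′d, c = c′d for the gcd d, which Bézout writes as αb + βc
lcm : ∀ b c .{{_ : NonZero b}} .{{_ : NonZero c}} → CommonMultiple b c
lcm b c with Bézout.lemma b c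
... | Bézout.result d gcd identity with GCD.commonDivisor gcd
... | ℕ.divides b′ refl , ℕ.divides c′ refl =
  lcm-from-gcd b′ c′ d {{ℕP.m*n≢0⇒m≢0 b′}} {{ℕP.m*n≢0⇒m≢0 c′}} {{ℕP.m*n≢0⇒n≢0 b′}}
    (bézout identity)

solve-pair : ∀ r s {a b} → r - s ∈⟨ + a , + b ⟩ → ∃ λ x → x ≡ r [mod a ] × x ≡ s [mod b ]
solve-pair r s {a} {b} (combination u v e) =
  r - u * + a , - u ·mod cancel r u (+ a) , v ·mod (begin
    (r - u * + a) - s            ≡⟨ swap r s (u * + a) ⟩
    (r - s) - u * + a            ≡⟨ cong (_- u * + a) e ⟩
    u * + a + v * + b - u * + a  ≡⟨ cancel′ (u * + a) (v * + b) ⟩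
    v * + b                      ∎)
  where open ≡-Reasoning
        cancel : ∀ r u a → (r - u * a) - r ≡ - u * a
        cancel = solve-∀
        swap : ∀ r s t → (r - t) - s ≡ (r - s) - t
        swap = solve-∀
        cancel′ : ∀ s t → s + t - s ≡ t
        cancel′ = solve-∀

System : Set
System = List (ℤ × ℕ)

Solves : ℤ → ℤ × ℕ → Set
Solves x c = x ≡ proj₁ c [mod proj₂ c ]

-- r - s ∈ aℤ + bℤ (i.e. gcd(a, b) ∣ r - s): x ≡ r (mod a), x ≡ s (mod b) are solvable together
Compatible : ℤ × ℕ → ℤ × ℕ → Set
Compatible c c′ = proj₁ c - proj₁ c′ ∈⟨ + proj₂ c , + proj₂ c′ ⟩

-- The solution set of a system is a full class modulo some M (a least common
-- multiple of the moduli, in the sense of CommonMultiple.meet)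
record Solution (S : System) : Set where
  field
    x            : ℤ
    modulus      : ℕ
    nonZero      : NonZero modulus
    class-solves : ∀ {y} → y ≡ x [mod modulus ] → All (Solves y) S
    meet         : ∀ {a D} → All (λ c → D ∈⟨ a , + proj₂ c ⟩) S → D ∈⟨ a , + modulus ⟩

crt : (S : System) → All (λ c → NonZero (proj₂ c)) S → AllPairs Compatible S → Solution S
crt [] [] [] = record
  { x = 0ℤ ; modulus = 1 ; nonZero = _ ; class-solves = λ _ → []
  ; meet = λ {a} {D} _ → combination 0ℤ D (sym (trans (ℤP.+-identityˡ (D * + 1)) (ℤP.*-identityʳ D))) }
crt ((r , m) ∷ S) (m≢0 ∷ nonZeros) (compatible ∷ pairwise) = record
  { x            = x′
  ; modulus      = L.l
  ; nonZero      = L.nonZero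
  ; class-solves = λ y≡x′ → ≡-trans (≡-weaken L.b∣l y≡x′) x′≡r
                          ∷ T.class-solves (≡-trans (≡-weaken L.c∣l y≡x′) x′≡x)
  ; meet         = λ { (D∈m ∷ D∈S) → L.meet D∈m (T.meet D∈S) }
  }
  where
  module T = Solution (crt S nonZeros pairwise)
  module L = CommonMultiple (lcm m T.modulus {{m≢0}} {{T.nonZero}})
  -- r - x lies in m ℤ + mᵢ ℤ for every congruence of the tail, hence in m ℤ + M ℤ
  r-x∈ : r - T.x ∈⟨ + m , + T.modulus ⟩
  r-x∈ = T.meet (zipWith (λ (c , x≡s) → ∈-resp-≡ c (≡-- (≡-refl {x = r}) (≡-sym x≡s)))
                             (compatible , T.class-solves ≡-refl))
  x′ : ℤ
  x′ = proj₁ (solve-pair r T.x r-x∈)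
  x′≡r : x′ ≡ r [mod m ]
  x′≡r = proj₁ (proj₂ (solve-pair r T.x r-x∈))
  x′≡x : x′ ≡ T.x [mod T.modulus ]
  x′≡x = proj₂ (proj₂ (solve-pair r T.x r-x∈))

crt-ℕ : (S : System) → All (λ c → NonZero (proj₂ c)) S → AllPairs Compatible S →
        ∃ λ (x : ℕ) → All (Solves (+ x)) S
crt-ℕ S nonZeros pairwise = x %ℕ modulus , class-solves (%ℕ-≡ x modulus)
  where open Solution (crt S nonZeros pairwise)
        instance _ = nonZero

patch : ℕ → (ℕ → ℕ) → ℕ → ℕ → ℕ
patch m h x a with a <? m
... | yes _ = h a
... | no  _ = x

patch-< : ∀ {m h x a} → a < m → patch m h x a ≡ h a
patch-< {m} {a = a} a<m with a <? m
... | yes _   = refl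
... | no  a≮m = contradiction a<m a≮m

patch-≡ : ∀ {m h x} → patch m h x m ≡ x
patch-≡ {m} with m <? m
... | yes m<m = contradiction m<m (ℕP.<-irrefl refl)
... | no  _   = refl

below-suc : ∀ {P : ℕ → Set} {m a} → (∀ {a} → a < m → P a) → P m → a < suc m → P a
below-suc below at a<1+m with ℕP.m<1+n⇒m<n∨m≡n a<1+m
... | inj₁ a<m  = below a<m
... | inj₂ refl = at

∣-from-≡ : ∀ {a b x y} → b ≤ a → x ≡ y [mod a ∸ b ] → (+ a - + b) ∣ x - y
∣-from-≡ b≤a (mod∣ a∸b∣x-y) = subst (_∣ _) (+-∸ b≤a) a∸b∣x-y

∣-swap : ∀ {a b x y} → (a - b) ∣ (x - y) → (b - a) ∣ (y - x)
∣-swap {a} {b} {x} {y} (divides q e) = divides q (begin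
  y - x            ≡⟨ flip x y ⟩
  - (x - y)        ≡⟨ cong -_ e ⟩
  - (q * (a - b))  ≡⟨ neg-inside q a b ⟩
  q * (b - a)      ∎)
  where open ≡-Reasoning
        flip : ∀ x y → y - x ≡ - (x - y)
        flip = solve-∀
        neg-inside : ∀ q a b → - (q * (a - b)) ≡ q * (b - a)
        neg-inside = solve-∀

congPres-from-< : (F : ℕ → ℕ) → (∀ {a b} → b < a → + F a ≡ + F b [mod a ∸ b ]) → CongPresℕ F
congPres-from-< F preserves a b = ∣⇒∣ᵤ signed
  where
  signed : (+ a - + b) ∣ (+ F a - + F b)
  signed with ℕP.<-cmp a b
  ... | tri< a<b _ _  = ∣-swap {+ b} {+ a} {+ F b} {+ F a} (∣-from-≡ (ℕP.<⇒≤ a<b) (preserves a<b))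
  ... | tri≈ _ refl _ = divides 0ℤ (trans (ℤP.+-inverseʳ (+ F a)) (sym (ℤP.*-zeroˡ (+ a - + a))))
  ... | tri> _ _ b<a  = ∣-from-≡ (ℕP.<⇒≤ b<a) (preserves b<a)

-- (1) ⇒ (2): every congruence preserving f lifts

module Lifting (n : ℕ) .{{_ : NonZero n}} (f : Fin n → Fin n) (f-cp : CongPresₙ n f) where
  open Residues n

  -- a lift F of f must satisfy F a ≡ g a (mod n)
  g : ℕ → ℤ
  g a = rep (f (π n a))

  g-congruent : ∀ a b → ∃ λ d → g a - g b ≡ d * (+ a - + b) [mod n ]
  g-congruent a b with f-cp (π n a) (π n b)
  ... | d , fa-fb≡d[a-b] = rep d , (begin
    g a - g b                              ≈⟨ rep-sub (f (π n a)) (f (π n b)) ⟨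
    rep (subₙ n (f (π n a)) (f (π n b)))   ≡⟨ cong rep fa-fb≡d[a-b] ⟩
    rep (mulₙ n d (subₙ n (π n a) (π n b)))  ≈⟨ rep-mul d _ ⟩
    rep d * rep (subₙ n (π n a) (π n b))   ≈⟨ ≡-*ˡ (rep d) (rep-sub (π n a) (π n b)) ⟩
    rep d * (rep (π n a) - rep (π n b))    ≈⟨ ≡-*ˡ (rep d) (≡-- (rep-π a) (rep-π b)) ⟩
    rep d * (+ a - + b)                    ∎)
    where open ≡-mod-Reasoning n

  record PartialLift (m : ℕ) : Set where
    field
      h         : ℕ → ℕ
      lifts     : ∀ {a} → a < m → + h a ≡ g a [mod n ]
      preserves : ∀ {a b} → b < a → a < m → + h a ≡ + h b [mod a ∸ b ]

  -- the congruences the value at position m of an extension of h must satisfy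
  constraints : ℕ → (ℕ → ℕ) → System
  constraints m h = (g m , n) ∷ applyUpTo (λ b → + h b , m ∸ b) m

  module _ {m : ℕ} (P : PartialLift m) where
    open PartialLift P

    -- g m and h b are compatible, as h b ≡ g b and g m - g b ≡ d (m - b) modulo n
    compatible-with-g : ∀ {b} → b < m → Compatible (g m , n) (+ h b , m ∸ b)
    compatible-with-g {b} b<m = ∈-from-≡ d (+ (m ∸ b)) (begin
      g m - + h b          ≈⟨ ≡-- (≡-refl {x = g m}) (lifts b<m) ⟩
      g m - g b            ≈⟨ proj₂ (g-congruent m b) ⟩
      d * (+ m - + b)      ≡⟨ cong (d *_) (+-∸ (ℕP.<⇒≤ b<m)) ⟨
      d * + (m ∸ b)        ∎)
      where open ≡-mod-Reasoning n
            d = proj₁ (g-congruent m b)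

    -- h i and h j are compatible, as h j ≡ h i modulo j - i = (m - i) - (m - j)
    compatible-values : ∀ {i j} → i < j → j < m → Compatible (+ h i , m ∸ i) (+ h j , m ∸ j)
    compatible-values {i} {j} i<j j<m = ∈-from-difference (preserves i<j j<m) (begin
      + (j ∸ i)                      ≡⟨ +-∸ (ℕP.<⇒≤ i<j) ⟩
      + j - + i                      ≡⟨ telescope (+ m) (+ i) (+ j) ⟩
      (+ m - + i) - (+ m - + j)      ≡⟨ cong₂ _-_ (+-∸ i≤m) (+-∸ (ℕP.<⇒≤ j<m)) ⟨
      + (m ∸ i) - + (m ∸ j)          ∎)
      where open ≡-Reasoning
            i≤m = ℕP.<⇒≤ (ℕP.<-trans i<j j<m)
            telescope : ∀ m i j → j - i ≡ (m - i) - (m - j)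
            telescope = solve-∀

    constraints-nonZero : All (λ c → NonZero (proj₂ c)) (constraints m h)
    constraints-nonZero = ℕ.≢-nonZero (ℕ.≢-nonZero⁻¹ n)
                        ∷ All.applyUpTo⁺₁ _ m (λ b<m → ℕ.≢-nonZero (ℕP.m>n⇒m∸n≢0 b<m))

    constraints-compatible : AllPairs Compatible (constraints m h)
    constraints-compatible = All.applyUpTo⁺₁ _ m compatible-with-g
                           ∷ AllPairs.applyUpTo⁺₁ _ m compatible-values

    -- the Chinese remainder theorem provides the next value (abstract: only
    -- its specification matters, and unfolding the computation is expensive)
    abstract
      next-value : ∃ λ x → + x ≡ g m [mod n ] × (∀ {b} → b < m → + x ≡ + h b [mod m ∸ b ])
      next-value = from-solution (crt-ℕ (constraints m h) constraints-nonZero constraints-compatible)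
        where
        from-solution : (∃ λ x → All (Solves (+ x)) (constraints m h)) →
                        ∃ λ x → + x ≡ g m [mod n ] × (∀ {b} → b < m → + x ≡ + h b [mod m ∸ b ])
        from-solution (x , x≡gm ∷ x≡h) = x , x≡gm , All.applyUpTo⁻ _ m x≡h

    extend : PartialLift (suc m)
    extend = record { h = patch m h x ; lifts = lifts′ ; preserves = preserves′ }
      where
      x : ℕ
      x = proj₁ next-value
      x≡gm : + x ≡ g m [mod n ]
      x≡gm = proj₁ (proj₂ next-value)
      x≡h : ∀ {b} → b < m → + x ≡ + h b [mod m ∸ b ]
      x≡h = proj₂ (proj₂ next-value)

      lifts′ : ∀ {a} → a < suc m → + patch m h x a ≡ g a [mod n ]
      lifts′ = below-suc {P = λ a → + patch m h x a ≡ g a [mod n ]}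
        (λ a<m → subst (λ t → + t ≡ _ [mod n ]) (sym (patch-< a<m)) (lifts a<m))
        (subst (λ t → + t ≡ g m [mod n ]) (sym (patch-≡ {m} {h})) x≡gm)

      preserves′ : ∀ {a b} → b < a → a < suc m → + patch m h x a ≡ + patch m h x b [mod a ∸ b ]
      preserves′ {b = b} b<a a<1+m = below-suc {P = λ a → b < a → + patch m h x a ≡ + patch m h x b [mod a ∸ b ]}
        (λ a<m b<a → subst₂ (λ s t → + s ≡ + t [mod _ ∸ b ])
          (sym (patch-< a<m)) (sym (patch-< (ℕP.<-trans b<a a<m))) (preserves b<a a<m))
        (λ b<m → subst₂ (λ s t → + s ≡ + t [mod m ∸ b ])
          (sym (patch-≡ {m} {h})) (sym (patch-< b<m)) (x≡h b<m))
        a<1+m b<a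

  stage : ∀ m → PartialLift m
  stage zero    = record { h = λ _ → 0 ; lifts = λ () ; preserves = λ _ () }
  stage (suc m) = extend (stage m)

  F : ℕ → ℕ
  F a = PartialLift.h (stage (suc a)) a

  stage-stable : ∀ {a m} → a < m → PartialLift.h (stage m) a ≡ F a
  stage-stable {m = suc m} = below-suc {P = λ a → PartialLift.h (stage (suc m)) a ≡ F a}
    (λ a<m → trans (patch-< a<m) (stage-stable a<m)) refl

  F-lifts : ∀ a → π n (F a) ≡ f (π n a)
  F-lifts a = rep-injective (≡-trans (rep-π (F a)) (PartialLift.lifts (stage (suc a)) (ℕP.n<1+n a)))

  -- stage (suc a) certifies both the value F a and its relation to earlier values
  F-preserves : ∀ {a b} → b < a → + F a ≡ + F b [mod a ∸ b ]
  F-preserves {a} {b} b<a = subst (λ t → + F a ≡ + t [mod a ∸ b ]) (stage-stable (ℕP.<-trans b<a (ℕP.n<1+n a)))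
    (PartialLift.preserves (stage (suc a)) b<a (ℕP.n<1+n a))

  F-congPres : CongPresℕ F
  F-congPres = congPres-from-< F F-preserves

-- (2) ⇒ (1): the reduction of a congruence preserving lift is congruence preserving

module Descent (n : ℕ) .{{_ : NonZero n}} (f : Fin n → Fin n) (F : ℕ → ℕ) (F-cp : CongPresℕ F)
               (F-lifts : ∀ a → π n (F a) ≡ f (π n a)) where
  open Residues n

  π-toℕ : ∀ x → π n (toℕ x) ≡ x
  π-toℕ x = rep-injective (rep-π (toℕ x))

  rep-f : ∀ x → rep (f x) ≡ + F (toℕ x) [mod n ]
  rep-f x = ≡-trans (≡-reflexive (cong rep (sym (trans (F-lifts (toℕ x)) (cong f (π-toℕ x)))))) (rep-π (F (toℕ x)))

  -- the factor d is the quotient (F x - F y) / (x - y), reduced modulo n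
  f-congPres : CongPresₙ n f
  f-congPres x y = d , rep-injective (begin
    rep (subₙ n (f x) (f y))     ≈⟨ rep-sub (f x) (f y) ⟩
    rep (f x) - rep (f y)        ≈⟨ ≡-- (rep-f x) (rep-f y) ⟩
    + F (toℕ x) - + F (toℕ y)    ≡⟨ Fx-Fy≡q[x-y] ⟩
    q * (rep x - rep y)          ≈⟨ ≡-* rep-d≡q (≡-refl {x = rep x - rep y}) ⟨
    rep d * (rep x - rep y)      ≈⟨ ≡-*ˡ (rep d) (rep-sub x y) ⟨
    rep d * rep (subₙ n x y)     ≈⟨ rep-mul d (subₙ n x y) ⟨
    rep (mulₙ n d (subₙ n x y))  ∎)
    where open ≡-mod-Reasoning n
          F-divides : (rep x - rep y) ∣ (+ F (toℕ x) - + F (toℕ y))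
          F-divides = ∣ᵤ⇒∣ (F-cp (toℕ x) (toℕ y))
          open _∣_ F-divides renaming (quotient to q; equality to Fx-Fy≡q[x-y])
          d = π n (q %ℕ n)
          rep-d≡q : rep d ≡ q [mod n ]
          rep-d≡q = ≡-trans (rep-π (q %ℕ n)) (%ℕ-≡ q n)

theorem5 : (n : ℕ) .{{_ : NonZero n}} → 2 ≤ n → (f : Fin n → Fin n) →
    CongPresₙ n f ⇔ (∃ λ (F : ℕ → ℕ) → CongPresℕ F × (∀ (a : ℕ) → π n (F a) ≡ f (π n a)))
theorem5 n _ f = mk⇔
  (λ f-cp → let open Lifting n f f-cp in F , F-congPres , F-lifts)
  (λ (F , F-cp , F-lifts) → Descent.f-congPres n f F F-cp F-lifts)
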